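{- Let $(G,c,k)$ be an instance of \textsc{Multi-STC} where $c\ge 3$ is odd, and let $A\subseteq\mathscr{P}$ be a periphery component. Then $A$ is good.
   Context: A $c$-colored labeling of $G=(V,E)$ is a partition $L=(S^1_L,\dots,S^c_L,W_L)$ of $E$; it is an STC-labeling if there are no $\{u,v\},\{v,w\}\in S^i_L$ ($u\ne w$) with $\{u,w\}\notin E$. \textsc{Multi-STC}: given $G$ and $c,k$, decide whether $G$ has a $c$-colored STC-labeling with $|W_L|\le k$. Fix $D\subseteq E$ such that $(V,E\setminus D)$ has maximum degree at most $\lfloor c/2\rfloor+1$; the core $\mathscr{C}$ is the set of vertices incident with an edge of $D$, the periphery is $\mathscr{P}=V\setminus\mathscr{C}$, and a periphery component is the vertex set of a connected component of $G[\mathscr{P}]$. Labelings $L,L'$ are partially equal on $E'$ if for all $e\in E'$ and all $i$, $e\in S^i_L\iff e\in S^i_{L'}$. A periphery component $A$ is good if for every STC-labeling $L$ of $G$ with $E(A)\subseteq W_L$ (where $E(A)$ = edges with both endpoints in $A$) there is an STC-labeling $L'$ partially equal to $L$ on $E\setminus E(A)$ with $W_{L'}\cap E(A)=\emptyset$. -}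

module Defs where

open import Data.Nat using (ℕ; _≤_; _/_; _+_)
open import Data.Fin using (Fin)
open import Data.Bool using (Bool; true; false; T; not; _∧_; if_then_else_)
open import Data.List using (List; map; allFin)
open import Data.Nat.ListAction using (sum)
open import Data.Maybe using (Maybe; just; nothing)
open import Data.Product using (Σ; ∃; _×_; _,_)
open import Relation.Nullary using (¬_)
open import Relation.Binary.PropositionalEquality using (_≡_; _≢_)

record Graph (n : ℕ) : Set where
  field
    adj     : Fin n → Fin n → Bool
    adj-sym : ∀ u v → adj u v ≡ adj v u
    irrefl  : ∀ v → adj v v ≡ false

open Graph public

Edge : ∀ {n} → Graph n → Fin n → Fin n → Set
Edge G u v = T (adj G u v)

-- A c-colored labeling: each edge gets a label in Maybe (Fin c);
-- just i means the edge is in S^(i+1), nothing means it is in W.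
-- Values on non-edges are irrelevant; labels on edges are symmetric.
record Labeling {n : ℕ} (G : Graph n) (c : ℕ) : Set where
  field
    lab     : Fin n → Fin n → Maybe (Fin c)
    lab-sym : ∀ u v → Edge G u v → lab u v ≡ lab v u

open Labeling public

IsSTC : ∀ {n c} (G : Graph n) → Labeling G c → Set
IsSTC G L = ∀ u v w (i : Fin _) → u ≢ w → Edge G u v → Edge G v w →
            lab L u v ≡ just i → lab L v w ≡ just i → Edge G u w

degMinus : ∀ {n} → Graph n → (Fin n → Fin n → Bool) → Fin n → ℕ
degMinus {n} G D v = sum (map (λ u → if adj G u v ∧ not (D u v) then 1 else 0) (allFin n))

record ValidD {n : ℕ} (G : Graph n) (c : ℕ) (D : Fin n → Fin n → Bool) : Set where
  field
    D-sym  : ∀ u v → D u v ≡ D v u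
    D⊆E    : ∀ u v → T (D u v) → Edge G u v
    maxdeg : ∀ v → degMinus G D v ≤ c / 2 + 1

Core : ∀ {n} → (Fin n → Fin n → Bool) → Fin n → Set
Core D v = ∃ λ u → T (D u v)

Periphery : ∀ {n} → (Fin n → Fin n → Bool) → Fin n → Set
Periphery D v = ¬ Core D v

data ReachP {n : ℕ} (G : Graph n) (D : Fin n → Fin n → Bool) (a : Fin n) : Fin n → Set where
  here : ReachP G D a a
  step : ∀ {x y} → ReachP G D a x → Edge G x y → Periphery D y → ReachP G D a y

IsPeripheryComponent : ∀ {n} → Graph n → (Fin n → Fin n → Bool) → (Fin n → Set) → Set
IsPeripheryComponent {n} G D A =
  Σ (Fin n) λ a → Periphery D a × (∀ x → (A x → ReachP G D a x) × (ReachP G D a x → A x))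

PartiallyEqual : ∀ {n c} (G : Graph n) → (Fin n → Fin n → Set) → Labeling G c → Labeling G c → Set
PartiallyEqual G E' L L' = ∀ u v → Edge G u v → E' u v → lab L u v ≡ lab L' u v

InEA : ∀ {n} → (Fin n → Set) → Fin n → Fin n → Set
InEA A u v = A u × A v

Good : ∀ {n} (G : Graph n) (c : ℕ) → (Fin n → Set) → Set
Good G c A =
  ∀ (L : Labeling G c) → IsSTC G L →
    (∀ u v → Edge G u v → InEA A u v → lab L u v ≡ nothing) →
    Σ (Labeling G c) λ L' → IsSTC G L' ×
      PartiallyEqual G (λ u v → ¬ InEA A u v) L L' ×
      (∀ u v → Edge G u v → InEA A u v → lab L' u v ≢ nothing)

module Submission where

-- A periphery vertex u is incident with no edge of D, so its degree in G
-- is at most ⌊c/2⌋ + 1.  Hence, when an uncoloured edge uv of E(A) is to be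
-- coloured, the other edges at u and at v carry at most ⌊c/2⌋ + ⌊c/2⌋ < c
-- colours, and some colour i is used at neither end.  Giving uv colour i cannot
-- create an induced P₃ of colour i, so colouring the edges of E(A) greedily,
-- one at a time, turns L into an STC-labeling that agrees with L off E(A).

open import Data.Nat using (ℕ; zero; suc; _≤_; _<_; _+_; _*_; _%_; _/_; z≤n; s≤s)
open import Data.Nat.Properties
  using (≤-trans; n≤1+n; ≤-<-trans; <-≤-trans; m<1+n⇒m≤n; n≮n; +-comm; +-identityʳ; *-comm; +-mono-≤; ≤-reflexive)
open import Data.Nat.DivMod using (m≡m%n+[m/n]*n)
open import Data.Nat.ListAction using (sum)
open import Data.Bool using (Bool; true; false; T; not; _∧_; if_then_else_)
open import Data.Bool.Properties using (∧-identityʳ)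
open import Data.Fin using (Fin)
open import Data.Fin.Properties using (any?; _≟_; <⇒notInjective)
open import Data.Maybe using (Maybe; just; nothing)
open import Data.List using (List; []; _∷_; map; mapMaybe; filter; allFin; length; lookup; _++_; cartesianProduct)
open import Data.List.Properties using (map-cong; length-++; length-mapMaybe)
open import Data.List.Membership.Propositional using (_∈_; _∉_)
open import Data.List.Membership.Propositional.Properties
  using (∈-allFin; ∈-filter⁺; ∈-++⁺ˡ; ∈-++⁺ʳ; ∈-cartesianProduct⁺)
import Data.List.Membership.DecPropositional as DecMembership
open import Data.List.Relation.Unary.Any using (here; there; index)
open import Data.List.Relation.Unary.Any.Properties using (lookup-index)
open import Data.Product using (Σ; ∃; _×_; _,_; proj₁; proj₂)
open import Data.Sum using (_⊎_; inj₁; inj₂)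
open import Data.Empty using (⊥-elim)
open import Function using (_∘_)
open import Relation.Nullary using (¬_; Dec; yes; no; ¬?; does)
open import Relation.Nullary.Decidable
  using (_×-dec_; _⊎-dec_; map′; decidable-stable; dec-true; dec-false; T?)
open import Relation.Binary.PropositionalEquality
open import Defs

sum-indicator : ∀ {A : Set} (p : A → Bool) (xs : List A) →
                sum (map (λ x → if p x then 1 else 0) xs) ≡ length (filter (T? ∘ p) xs)
sum-indicator p [] = refl
sum-indicator p (x ∷ xs) with p x
... | true  = cong suc (sum-indicator p xs)
... | false = sum-indicator p xs

length-mapMaybe-< : ∀ {A B : Set} (g : A → Maybe B) {x : A} {xs : List A} →
                    x ∈ xs → g x ≡ nothing → length (mapMaybe g xs) < length xs
length-mapMaybe-< g {xs = y ∷ ys} (here refl) gx≡nothing rewrite gx≡nothing =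
  s≤s (length-mapMaybe g ys)
length-mapMaybe-< g {xs = y ∷ ys} (there x∈ys) gx≡nothing with g y
... | just _  = s≤s (length-mapMaybe-< g x∈ys gx≡nothing)
... | nothing = ≤-trans (length-mapMaybe-< g x∈ys gx≡nothing) (n≤1+n _)

∈-mapMaybe⁺ : ∀ {A B : Set} (g : A → Maybe B) {x : A} {y : B} {xs : List A} →
              x ∈ xs → g x ≡ just y → y ∈ mapMaybe g xs
∈-mapMaybe⁺ g {xs = z ∷ zs} (here refl) gx≡y rewrite gx≡y = here refl
∈-mapMaybe⁺ g {xs = z ∷ zs} (there x∈zs) gx≡y with g z
... | just _  = there (∈-mapMaybe⁺ g x∈zs gx≡y)
... | nothing = ∈-mapMaybe⁺ g x∈zs gx≡y

_∈?_ : ∀ {c} (i : Fin c) (xs : List (Fin c)) → Dec (i ∈ xs)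
i ∈? xs = DecMembership._∈?_ _≟_ i xs

-- A list of fewer than c colours misses some colour: otherwise the position of
-- each colour in the list would inject Fin c into Fin (length xs).
missing-colour : ∀ {c} (xs : List (Fin c)) → length xs < c → ∃ λ i → i ∉ xs
missing-colour {c} xs short with any? (λ i → ¬? (i ∈? xs))
... | yes found = found
... | no  none  = ⊥-elim (<⇒notInjective short position-injective)
  where
  covered : ∀ i → i ∈ xs
  covered i = decidable-stable (i ∈? xs) (λ i∉xs → none (i , i∉xs))

  position : Fin c → Fin (length xs)
  position i = index (covered i)

  position-injective : ∀ {i j} → position i ≡ position j → i ≡ j
  position-injective {i} {j} same =
    trans (lookup-index (covered i)) (trans (cong (lookup xs) same) (sym (lookup-index (covered j))))

module _ {n : ℕ} (G : Graph n) where

  edge-sym : ∀ {u v} → Edge G u v → Edge G v u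
  edge-sym {u} {v} = subst T (adj-sym G u v)

  edge-irrefl : ∀ {u v} → Edge G u v → u ≢ v
  edge-irrefl {u} e refl = subst T (irrefl G u) e

  neighbours : Fin n → List (Fin n)
  neighbours u = filter (T? ∘ adj G u) (allFin n)

  degree : Fin n → ℕ
  degree u = length (neighbours u)

  ∈-neighbours : ∀ {u w} → Edge G u w → w ∈ neighbours u
  ∈-neighbours {u} = ∈-filter⁺ (T? ∘ adj G u) (∈-allFin _)

  degMinus-periphery : ∀ (D : Fin n → Fin n → Bool) {u} → Periphery D u → degMinus G D u ≡ degree u
  degMinus-periphery D {u} per = begin
    sum (map (λ w → if adj G w u ∧ not (D w u) then 1 else 0) (allFin n))
      ≡⟨ cong sum (map-cong (λ w → cong (λ b → if b then 1 else 0) (no-D-edge w)) (allFin n)) ⟩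
    sum (map (λ w → if adj G u w then 1 else 0) (allFin n))
      ≡⟨ sum-indicator (adj G u) (allFin n) ⟩
    degree u ∎
    where
    open ≡-Reasoning
    no-D-edge : ∀ w → adj G w u ∧ not (D w u) ≡ adj G u w
    no-D-edge w rewrite dec-false (T? (D w u)) (λ d → per (w , d)) =
      trans (∧-identityʳ (adj G w u)) (adj-sym G w u)

-- Reachability from a inside G[P] is decidable: the sets of vertices reachable
-- by walks of length ≤ k grow until they stabilise, which happens within n steps.
module PeripheryReachability {n : ℕ} (G : Graph n) (D : Fin n → Fin n → Bool) (a : Fin n) where

  open import Data.Vec using (tabulate)
  open import Data.Vec.Properties using (lookup∘tabulate; lookup⇒[]=; []=⇒lookup)
  open import Data.Fin.Subset using (Subset; ⁅_⁆; _∪_; _⊆_; _⊂_; ∣_∣) renaming (_∈_ to _∈ₛ_)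
  open import Data.Fin.Subset.Properties
    using (x∈⁅x⁆; x∈⁅y⁆⇒x≡y; x∈p∪q⁺; x∈p∪q⁻; p⊆p∪q; _⊂?_; p⊂q⇒∣p∣<∣q∣; ∣p∣≤n)
    renaming (_∈?_ to _∈ₛ?_)

  Step : Fin n → Fin n → Set
  Step x y = Edge G x y × Periphery D y

  step? : ∀ x y → Dec (Step x y)
  step? x y = T? (adj G x y) ×-dec ¬? (any? (λ u → T? (D u y)))

  ⟦_⟧ : {P : Fin n → Set} → (∀ x → Dec (P x)) → Subset n
  ⟦ P? ⟧ = tabulate (does ∘ P?)

  ∈⟦⟧⁺ : {P : Fin n → Set} (P? : ∀ x → Dec (P x)) {x : Fin n} → P x → x ∈ₛ ⟦ P? ⟧
  ∈⟦⟧⁺ P? {x} px = lookup⇒[]= x ⟦ P? ⟧ (trans (lookup∘tabulate (does ∘ P?) x) (dec-true (P? x) px))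

  ∈⟦⟧⁻ : {P : Fin n → Set} (P? : ∀ x → Dec (P x)) {x : Fin n} → x ∈ₛ ⟦ P? ⟧ → P x
  ∈⟦⟧⁻ P? {x} x∈ with P? x | trans (sym (lookup∘tabulate (does ∘ P?) x)) ([]=⇒lookup x∈)
  ... | yes px | _  = px
  ... | no  _  | ()

  successor? : ∀ (S : Subset n) y → Dec (∃ λ x → x ∈ₛ S × Step x y)
  successor? S y = any? (λ x → (x ∈ₛ? S) ×-dec step? x y)

  successors : Subset n → Subset n
  successors S = ⟦ successor? S ⟧

  stage : ℕ → Subset n
  stage zero    = ⁅ a ⁆
  stage (suc k) = stage k ∪ successors (stage k)

  stage-sound : ∀ k {x} → x ∈ₛ stage k → ReachP G D a x
  stage-sound zero    x∈ = subst (ReachP G D a) (sym (x∈⁅y⁆⇒x≡y a x∈)) here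
  stage-sound (suc k) x∈ with x∈p∪q⁻ (stage k) (successors (stage k)) x∈
  ... | inj₁ old = stage-sound k old
  ... | inj₂ new with ∈⟦⟧⁻ (successor? (stage k)) new
  ...   | w , w∈ , e , per = step (stage-sound k w∈) e per

  a∈stage : ∀ k → a ∈ₛ stage k
  a∈stage zero    = x∈⁅x⁆ a
  a∈stage (suc k) = x∈p∪q⁺ (inj₁ (a∈stage k))

  Stable : ℕ → Set
  Stable k = successors (stage k) ⊆ stage k

  stable-complete : ∀ k → Stable k → ∀ {x} → ReachP G D a x → x ∈ₛ stage k
  stable-complete k st here           = a∈stage k
  stable-complete k st (step r e per) =
    st (∈⟦⟧⁺ (successor? (stage k)) (_ , stable-complete k st r , e , per))

  not-growing⇒stable : ∀ k → ¬ (stage k ⊂ stage (suc k)) → Stable k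
  not-growing⇒stable k not-growing {y} y∈ with y ∈ₛ? stage k
  ... | yes y∈k = y∈k
  ... | no  y∉k = ⊥-elim (not-growing (p⊆p∪q _ , y , x∈p∪q⁺ (inj₂ y∈) , y∉k))

  growth : ∀ k → Σ ℕ Stable ⊎ k ≤ ∣ stage k ∣
  growth zero = inj₂ z≤n
  growth (suc k) with growth k
  ... | inj₁ stable = inj₁ stable
  ... | inj₂ k≤ with stage k ⊂? stage (suc k)
  ...   | yes grows      = inj₂ (≤-<-trans k≤ (p⊂q⇒∣p∣<∣q∣ grows))
  ...   | no not-growing = inj₁ (k , not-growing⇒stable k not-growing)

  -- A set of at most n vertices cannot grow n + 1 times.
  stabilises : Σ ℕ Stable
  stabilises with growth (suc n)
  ... | inj₁ stable = stable
  ... | inj₂ big    = ⊥-elim (n≮n n (≤-trans big (∣p∣≤n (stage (suc n)))))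

  reach? : ∀ x → Dec (ReachP G D a x)
  reach? x with stabilises
  ... | k , stable = map′ (stage-sound k) (stable-complete k stable) (x ∈ₛ? stage k)

reach-periphery : ∀ {n} {G : Graph n} {D : Fin n → Fin n → Bool} {a x} →
                  Periphery D a → ReachP G D a x → Periphery D x
reach-periphery per-a here             = per-a
reach-periphery per-a (step _ _ per-x) = per-x

just≢nothing : ∀ {A : Set} {x : A} → just x ≢ nothing
just≢nothing ()

module GreedyColouring {n : ℕ} (G : Graph n) (c : ℕ)
                       (B : Fin n → Set) (B? : ∀ x → Dec (B x))
                       (d : ℕ) (room : d + d < c)
                       (lowDegree : ∀ u → B u → degree G u ≤ d + 1) where

  Colouring : Set
  Colouring = Fin n → Fin n → Maybe (Fin c)

  BEdge : Fin n → Fin n → Set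
  BEdge u v = Edge G u v × InEA B u v

  bEdge? : ∀ u v → Dec (BEdge u v)
  bEdge? u v = T? (adj G u v) ×-dec (B? u ×-dec B? v)

  bEdge-sym : ∀ {u v} → BEdge u v → BEdge v u
  bEdge-sym (e , bu , bv) = edge-sym G e , bv , bu

  usedAt : Colouring → Fin n → List (Fin c)
  usedAt f u = mapMaybe (f u) (neighbours G u)

  FreeAt : Colouring → Fin n → Fin c → Set
  FreeAt f u i = ∀ w → Edge G u w → f u w ≢ just i

  unused⇒free : ∀ f u {i} → i ∉ usedAt f u → FreeAt f u i
  unused⇒free f u i∉ w e fuw≡i = i∉ (∈-mapMaybe⁺ (f u) (∈-neighbours G e) fuw≡i)

  few-used : ∀ f {u v} → B u → Edge G u v → f u v ≡ nothing → length (usedAt f u) ≤ d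
  few-used f {u} bu e fuv≡nothing = m<1+n⇒m≤n (<-≤-trans
    (length-mapMaybe-< (f u) (∈-neighbours G e) fuv≡nothing)
    (≤-trans (lowDegree u bu) (≤-reflexive (+-comm d 1))))

  Ends : Fin n → Fin n → Fin n → Fin n → Set
  Ends u v x y = (x ≡ u × y ≡ v) ⊎ (x ≡ v × y ≡ u)

  ends? : ∀ u v x y → Dec (Ends u v x y)
  ends? u v x y = ((x ≟ u) ×-dec (y ≟ v)) ⊎-dec ((x ≟ v) ×-dec (y ≟ u))

  ends-swap : ∀ {u v x y} → Ends u v x y → Ends u v y x
  ends-swap (inj₁ (x≡u , y≡v)) = inj₂ (y≡v , x≡u)
  ends-swap (inj₂ (x≡v , y≡u)) = inj₁ (y≡u , x≡v)

  ends-twice : ∀ {u v x y z} → x ≢ y → Ends u v x y → Ends u v y z → x ≡ z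
  ends-twice x≢y (inj₁ (refl , refl)) (inj₁ (refl , _))    = ⊥-elim (x≢y refl)
  ends-twice x≢y (inj₁ (refl , refl)) (inj₂ (_ , refl))    = refl
  ends-twice x≢y (inj₂ (refl , refl)) (inj₁ (_ , refl))    = refl
  ends-twice x≢y (inj₂ (refl , refl)) (inj₂ (refl , _))    = ⊥-elim (x≢y refl)

  free-at-end : ∀ {f u v x y i} → Ends u v x y → FreeAt f u i → FreeAt f v i → FreeAt f y i
  free-at-end (inj₁ (_ , refl)) free-u free-v = free-v
  free-at-end (inj₂ (_ , refl)) free-u free-v = free-u

  assign : Colouring → Fin n → Fin n → Fin c → Colouring
  assign f u v i x y with ends? u v x y
  ... | yes _ = just i
  ... | no  _ = f x y

  assign-here : ∀ f u v i → assign f u v i u v ≡ just i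
  assign-here f u v i with ends? u v u v
  ... | yes _        = refl
  ... | no  not-ends = ⊥-elim (not-ends (inj₁ (refl , refl)))

  Extends : Colouring → Colouring → Set
  Extends f f′ = ∀ x y → f x y ≢ nothing → f′ x y ≢ nothing

  extends-refl : ∀ {f} → Extends f f
  extends-refl _ _ coloured = coloured

  assign-extends : ∀ f u v i → Extends f (assign f u v i)
  assign-extends f u v i x y coloured with ends? u v x y
  ... | yes _ = λ ()
  ... | no  _ = coloured

  module _ (L : Labeling G c) where

    record Invariant (f : Colouring) : Set where
      field
        symmetric : ∀ u v → Edge G u v → f u v ≡ f v u
        outside   : ∀ u v → ¬ BEdge u v → f u v ≡ lab L u v
        proper    : ∀ u v w i → u ≢ w → BEdge u v → Edge G v w → f u v ≡ just i → f v w ≢ just i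

    open Invariant

    toLabeling : ∀ {f} → Invariant f → Labeling G c
    toLabeling {f} inv = record { lab = f ; lab-sym = symmetric inv }

    -- An induced P₃ of one colour would need an edge of E(B) (excluded by
    -- properness) or lie entirely outside E(B) (excluded by L being STC).
    invariant⇒STC : ∀ {f} → IsSTC G L → (inv : Invariant f) → IsSTC G (toLabeling inv)
    invariant⇒STC {f} stc inv u v w i u≢w uv vw fuv fvw with bEdge? u v | bEdge? v w
    ... | yes buv | _       = ⊥-elim (proper inv u v w i u≢w buv vw fuv fvw)
    ... | no  _   | yes bvw = ⊥-elim (proper inv w v u i (u≢w ∘ sym) (bEdge-sym bvw) (edge-sym G uv)
                                (trans (symmetric inv w v (edge-sym G vw)) fvw)
                                (trans (symmetric inv v u (edge-sym G uv)) fuv))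
    ... | no ¬buv | no ¬bvw = stc u v w i u≢w uv vw
                                (trans (sym (outside inv u v ¬buv)) fuv)
                                (trans (sym (outside inv v w ¬bvw)) fvw)

    initial : (∀ u v → Edge G u v → InEA B u v → lab L u v ≡ nothing) → Invariant (lab L)
    initial weak = record
      { symmetric = lab-sym L
      ; outside   = λ _ _ _ → refl
      ; proper    = λ u v _ _ _ (uv , inB) _ luv≡i _ → just≢nothing (trans (sym luv≡i) (weak u v uv inB))
      }

    assign-invariant : ∀ {f u v i} → Invariant f → BEdge u v → FreeAt f u i → FreeAt f v i →
                       Invariant (assign f u v i)
    assign-invariant {f} {u} {v} {i} inv buv free-u free-v =
      record { symmetric = symmetric′ ; outside = outside′ ; proper = proper′ }
      where

      symmetric′ : ∀ x y → Edge G x y → assign f u v i x y ≡ assign f u v i y x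
      symmetric′ x y xy with ends? u v x y | ends? u v y x
      ... | yes _   | yes _   = refl
      ... | no  _   | no  _   = symmetric inv x y xy
      ... | yes exy | no ¬eyx = ⊥-elim (¬eyx (ends-swap exy))
      ... | no ¬exy | yes eyx = ⊥-elim (¬exy (ends-swap eyx))

      outside′ : ∀ x y → ¬ BEdge x y → assign f u v i x y ≡ lab L x y
      outside′ x y ¬bxy with ends? u v x y
      ... | yes (inj₁ (refl , refl)) = ⊥-elim (¬bxy buv)
      ... | yes (inj₂ (refl , refl)) = ⊥-elim (¬bxy (bEdge-sym buv))
      ... | no  _                    = outside inv x y ¬bxy

      proper′ : ∀ x y z j → x ≢ z → BEdge x y → Edge G y z →
                assign f u v i x y ≡ just j → assign f u v i y z ≢ just j
      proper′ x y z j x≢z bxy yz fxy fyz with ends? u v x y | ends? u v y z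
      ... | yes exy | yes eyz = x≢z (ends-twice (edge-irrefl G (proj₁ bxy)) exy eyz)
      ... | yes exy | no  _   = free-at-end exy free-u free-v z yz (trans fyz (sym fxy))
      ... | no  _   | yes eyz = free-at-end (ends-swap eyz) free-u free-v x (edge-sym G (proj₁ bxy))
                                  (trans (sym (symmetric inv x y (proj₁ bxy))) (trans fxy (sym fyz)))
      ... | no  _   | no  _   = proper inv x y z j x≢z bxy yz fxy fyz

    -- An uncoloured edge of E(B) has a colour free at both ends: together the
    -- two ends use at most d + d < c colours.
    free-colour : ∀ {f u v} → Invariant f → BEdge u v → f u v ≡ nothing →
                  ∃ λ i → FreeAt f u i × FreeAt f v i
    free-colour {f} {u} {v} inv (uv , bu , bv) fuv≡nothing
      with missing-colour (usedAt f u ++ usedAt f v) short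
      where
      fvu≡nothing : f v u ≡ nothing
      fvu≡nothing = trans (sym (symmetric inv u v uv)) fuv≡nothing

      short : length (usedAt f u ++ usedAt f v) < c
      short = ≤-<-trans
        (≤-trans (≤-reflexive (length-++ (usedAt f u)))
                 (+-mono-≤ (few-used f bu uv fuv≡nothing) (few-used f bv (edge-sym G uv) fvu≡nothing)))
        room
    ... | i , i∉ = i , unused⇒free f u (i∉ ∘ ∈-++⁺ˡ) , unused⇒free f v (i∉ ∘ ∈-++⁺ʳ (usedAt f u))

    colourPair : ∀ f → Invariant f → ∀ u v →
                 Σ Colouring λ f′ → Invariant f′ × Extends f f′ × (BEdge u v → f′ u v ≢ nothing)
    colourPair f inv u v with bEdge? u v | f u v in fuv
    ... | no ¬buv | _      = f , inv , extends-refl , λ buv → ⊥-elim (¬buv buv)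
    ... | yes _   | just _ = f , inv , extends-refl , λ _ → just≢nothing ∘ trans (sym fuv)
    ... | yes buv | nothing with free-colour inv buv fuv
    ...   | i , free-u , free-v =
      assign f u v i , assign-invariant inv buv free-u free-v , assign-extends f u v i ,
      λ _ → just≢nothing ∘ trans (sym (assign-here f u v i))

    colourAll : ∀ f → Invariant f → (ps : List (Fin n × Fin n)) →
                Σ Colouring λ f′ → Invariant f′ × Extends f f′ ×
                  (∀ {u v} → (u , v) ∈ ps → BEdge u v → f′ u v ≢ nothing)
    colourAll f inv [] = f , inv , extends-refl , λ ()
    colourAll f inv ((u , v) ∷ ps) with colourPair f inv u v
    ... | f₁ , inv₁ , ext₁ , uv-coloured with colourAll f₁ inv₁ ps
    ...   | f₂ , inv₂ , ext₂ , ps-coloured = f₂ , inv₂ , (λ x y → ext₂ x y ∘ ext₁ x y) , coloured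
      where
      coloured : ∀ {x y} → (x , y) ∈ (u , v) ∷ ps → BEdge x y → f₂ x y ≢ nothing
      coloured (here refl) bxy = ext₂ u v (uv-coloured bxy)
      coloured (there xy∈ps) bxy = ps-coloured xy∈ps bxy

  lowDegree⇒good : Good G c B
  lowDegree⇒good L stc weak
    with colourAll L (lab L) (initial L weak) (cartesianProduct (allFin n) (allFin n))
  ... | f , inv , _ , coloured =
    toLabeling L inv , invariant⇒STC L stc inv ,
    (λ u v _ ¬inB → sym (Invariant.outside inv u v (¬inB ∘ proj₂))) ,
    (λ u v uv inB → coloured (∈-cartesianProduct⁺ (∈-allFin u) (∈-allFin v)) (uv , inB))

odd⇒halves<c : ∀ c → c % 2 ≡ 1 → c / 2 + c / 2 < c
odd⇒halves<c c odd = ≤-reflexive (sym (begin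
  c                          ≡⟨ m≡m%n+[m/n]*n c 2 ⟩
  c % 2 + c / 2 * 2          ≡⟨ cong (_+ c / 2 * 2) odd ⟩
  suc (c / 2 * 2)            ≡⟨ cong suc (*-comm (c / 2) 2) ⟩
  suc (c / 2 + (c / 2 + 0))  ≡⟨ cong (λ m → suc (c / 2 + m)) (+-identityʳ (c / 2)) ⟩
  suc (c / 2 + c / 2)        ∎))
  where open ≡-Reasoning

-- A is decidable, as reachability in G[P] is; its vertices lie in the periphery,
-- so their degree is bounded by ⌊c/2⌋ + 1; hence the greedy lemma applies.
proposition18 : ∀ {n : ℕ} (G : Graph n) (c k : ℕ) → 3 ≤ c → c % 2 ≡ 1 →
                  (D : Fin n → Fin n → Bool) → ValidD G c D →
                  (A : Fin n → Set) → IsPeripheryComponent G D A →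
                  Good G c A
proposition18 G c _ _ odd D valid A (a , per-a , A⇔reach) =
  GreedyColouring.lowDegree⇒good G c A A? (c / 2) (odd⇒halves<c c odd) lowDegree
  where
  A? : ∀ x → Dec (A x)
  A? x = map′ (proj₂ (A⇔reach x)) (proj₁ (A⇔reach x)) (PeripheryReachability.reach? G D a x)

  lowDegree : ∀ u → A u → degree G u ≤ c / 2 + 1
  lowDegree u au = subst (_≤ c / 2 + 1)
    (degMinus-periphery G D (reach-periphery per-a (proj₁ (A⇔reach u) au)))
    (ValidD.maxdeg valid u)
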